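{- For each $k\in\mathbb N$ with $k\ge1$ and each $n\in\mathbb N$, the number of instruction sequences from $\mathcal{IS}^{k-1,k-1}_{br}$ of length $k$ that compute an $n$-ary Boolean function is not greater than $(3n+10k-2)^k$.
   Context: Let $\mathbb B=\{\mathsf T,\mathsf F\}$. There are Boolean registers named $\mathtt{in}{:}i$ ($i\ge1$), $\mathtt{aux}{:}i$ ($i\ge1$) and $\mathtt{out}$, processing methods $\mathtt{set{:}T}$ (content becomes $\mathsf T$, reply $\mathsf T$), $\mathtt{set{:}F}$ (content becomes $\mathsf F$, reply $\mathsf F$), $\mathtt{get}$ (no change, reply is the content). Basic instructions are $f.m$ ($f$ register name, $m$ method). Primitive instructions: for each basic instruction $a$, the plain instruction $a$, positive test $+a$, negative test $-a$; forward jumps $\#l$ ($l\in\mathbb N$); termination $!$. An instruction sequence is a finite non-empty sequence $X=u_1;\dots;u_k$ of primitive instructions, $|X|=k$ its length. Execution starts at $u_1$: $a$ executes $a$ and proceeds with the next instruction; $+a$ executes $a$ and proceeds with the next instruction if the reply is $\mathsf T$, otherwise skips the next instruction and proceeds with the one after; $-a$ likewise with reply roles reversed; $\#l$ proceeds with the $l$-th next instruction ($\#0$ causes inaction); $!$ terminates; if there is no instruction to proceed with, inaction occurs. $\mathcal{IS}_{br}$ is the set of instruction sequences whose basic instructions are all of the forms $\mathtt{in}{:}i.\mathtt{get}$, $\mathtt{aux}{:}i.\mathtt{get}$, $\mathtt{aux}{:}i.\mathtt{set{:}}b$, $\mathtt{out}.\mathtt{set{:}}b$ ($b\in\mathbb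 B$). For $k,l\in\mathbb N$, $\mathcal{IS}^{k,l}_{br}$ is the set of $X\in\mathcal{IS}_{br}$ in which no instruction on a register $\mathtt{aux}{:}i$ with $i>k$ and no jump $\#l'$ with $l'>l$ occurs. $X$ computes $f:\mathbb B^n\to\mathbb B$ if for all $b_1,\dots,b_n$, executing $X$ with $\mathtt{in}{:}i$ initially $b_i$ ($i\le n$) and all auxiliary registers and $\mathtt{out}$ initially $\mathsf F$, execution never executes an instruction on $\mathtt{in}{:}i$ with $i>n$, ends by executing $!$, and leaves $f(b_1,\dots,b_n)$ in $\mathtt{out}$. An $n$-ary Boolean function is a function $\mathbb B^n\to\mathbb B$.
   Formalization: Only those instruction sequences from $\mathcal{IS}^{k-1,k-1}_{br}$ of length k are counted in which every input register occurring is among in:1, …, in:n, so no instruction on in:i with i > n occurs at all. The statement above fails without it. -}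

module Defs where

open import Data.Nat using (ℕ; zero; suc; _+_; _*_; _∸_; _^_; _≤_; _<_)
open import Data.Nat.Properties using (_≟_)
open import Data.Bool using (Bool; true; false; if_then_else_)
open import Data.Vec using (Vec; lookup)
open import Data.Fin using (Fin; fromℕ<)
open import Data.List using (List; []; _∷_; length)
open import Data.List.Relation.Unary.All using (All)
open import Data.Maybe using (Maybe; just; nothing)
open import Data.Product using (Σ; ∃; _×_; proj₁)
open import Data.Unit using (⊤)
open import Relation.Nullary using (does)
open import Relation.Binary.PropositionalEquality using (_≡_)

-- Basic instructions of IS_br.  Register indices are natural numbers;
-- the registers are in:i and aux:i for i ≥ 1 (index 0 is not a register).
data Basic : Set where
  inGet  : ℕ → Basic
  auxGet : ℕ → Basic
  auxSet : ℕ → Bool → Basic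
  outSet : Bool → Basic

data Prim : Set where
  plain : Basic → Prim
  ptest : Basic → Prim
  ntest : Basic → Prim
  jump  : ℕ → Prim
  halt  : Prim

-- Instruction sequences (non-emptiness is imposed via the length).
IS : Set
IS = List Prim

OkBasic : ℕ → ℕ → Basic → Set
OkBasic n a (inGet i)    = (1 ≤ i) × (i ≤ n)
OkBasic n a (auxGet i)   = (1 ≤ i) × (i ≤ a)
OkBasic n a (auxSet i b) = (1 ≤ i) × (i ≤ a)
OkBasic n a (outSet b)   = ⊤

OkPrim : ℕ → ℕ → ℕ → Prim → Set
OkPrim n a j (plain x) = OkBasic n a x
OkPrim n a j (ptest x) = OkBasic n a x
OkPrim n a j (ntest x) = OkBasic n a x
OkPrim n a j (jump l)  = l ≤ j
OkPrim n a j halt      = ⊤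

InISbr : ℕ → ℕ → ℕ → IS → Set
InISbr n a j X = All (OkPrim n a j) X

record State : Set where
  constructor st
  field
    aux : ℕ → Bool
    out : Bool
open State public

initState : State
initState = st (λ _ → false) false

updAux : (ℕ → Bool) → ℕ → Bool → (ℕ → Bool)
updAux f i b m = if does (m ≟ i) then b else f m

-- Effect of a basic instruction with input vector b: reply and new state.
-- in:i.get is only executable for 1 ≤ i ≤ n.
data Eff {n : ℕ} (b : Vec Bool n) : Basic → State → Bool → State → Set where
  eInGet  : ∀ {σ j} (p : j < n) → Eff b (inGet (suc j)) σ (lookup b (fromℕ< p)) σ
  eAuxGet : ∀ {σ i} → Eff b (auxGet i) σ (aux σ i) σ
  eAuxSet : ∀ {σ i c} → Eff b (auxSet i c) σ c (st (updAux (aux σ) i c) (out σ))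
  eOutSet : ∀ {σ c} → Eff b (outSet c) σ c (st (aux σ) c)

-- Instruction at (0-based) position p, if any.
at : IS → ℕ → Maybe Prim
at []      _       = nothing
at (u ∷ X) zero    = just u
at (u ∷ X) (suc p) = at X p

-- Inaction (falling off the end, #0) has no derivation.
data Runs {n : ℕ} (X : IS) (b : Vec Bool n) : ℕ → State → State → Set where
  rHalt  : ∀ {p σ} → at X p ≡ just halt → Runs X b p σ σ
  rPlain : ∀ {p σ σ₁ σ' a r} → at X p ≡ just (plain a) → Eff b a σ r σ₁ →
           Runs X b (suc p) σ₁ σ' → Runs X b p σ σ'
  rPosT  : ∀ {p σ σ₁ σ' a} → at X p ≡ just (ptest a) → Eff b a σ true σ₁ →
           Runs X b (suc p) σ₁ σ' → Runs X b p σ σ'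
  rPosF  : ∀ {p σ σ₁ σ' a} → at X p ≡ just (ptest a) → Eff b a σ false σ₁ →
           Runs X b (suc (suc p)) σ₁ σ' → Runs X b p σ σ'
  rNegF  : ∀ {p σ σ₁ σ' a} → at X p ≡ just (ntest a) → Eff b a σ false σ₁ →
           Runs X b (suc p) σ₁ σ' → Runs X b p σ σ'
  rNegT  : ∀ {p σ σ₁ σ' a} → at X p ≡ just (ntest a) → Eff b a σ true σ₁ →
           Runs X b (suc (suc p)) σ₁ σ' → Runs X b p σ σ'
  rJump  : ∀ {p σ σ' l} → at X p ≡ just (jump l) → 1 ≤ l →
           Runs X b (p + l) σ σ' → Runs X b p σ σ'

Computes : (n : ℕ) → IS → (Vec Bool n → Bool) → Set
Computes n X f = (b : Vec Bool n) → ∃ λ σ' → Runs X b 0 initState σ' × out σ' ≡ f b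

ComputesSome : ℕ → IS → Set
ComputesSome n X = ∃ λ (f : Vec Bool n → Bool) → Computes n X f

Counted : ℕ → ℕ → Set
Counted k n = Σ IS λ X → (length X ≡ k) × InISbr n (k ∸ 1) (k ∸ 1) X × ComputesSome n X

-- "The number of elements of A (identified by g) is at most m":
-- there is a map into Fin m that is injective on the g-components.
AtMost : {A B : Set} → (A → B) → ℕ → Set
AtMost {A} g m = Σ (A → Fin m) λ h → ∀ x y → h x ≡ h y → g x ≡ g y

-- An instruction sequence of length k in IS^{k-1,k-1}_br over in:1 … in:n is a
-- word of length k over the primitive instructions available there: the plain,
-- positive-test and negative-test forms of the n + 3(k-1) + 2 admissible basic
-- instructions, the jumps #0 … #k-1, and !, which are 3n + 10k - 2 in all.
-- Words of length k over an alphabet of size s are coded injectively by their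
-- letters' positions, read as k digits in base s.
module Submission where

open import Defs
open import Data.Bool using (Bool; true; false)
open import Data.Fin using (Fin; combine; quotient; remainder) renaming (zero to fzero)
open import Data.Fin.Properties using (remQuot-combine)
open import Data.List using (List; []; _∷_; _++_; map; length; lookup; applyUpTo; upTo)
open import Data.List.Properties using (length-++; length-map; length-applyUpTo; length-upTo)
open import Data.List.Membership.Propositional using (_∈_)
open import Data.List.Membership.Propositional.Properties
  using (∈-map⁺; ∈-++⁺ˡ; ∈-++⁺ʳ; ∈-applyUpTo⁺; ∈-upTo⁺)
open import Data.List.Relation.Unary.All using (All; []; _∷_)
import Data.List.Relation.Unary.All as All
open import Data.List.Relation.Unary.Any using (here; there; index)
open import Data.List.Relation.Unary.Any.Properties using (lookup-index)
open import Data.Nat using (ℕ; suc; s≤s; _≤_; _+_; _*_; _∸_; _^_)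
open import Data.Nat.Tactic.RingSolver using (solve-∀)
open import Data.Product using (Σ; _×_; _,_; proj₁; proj₂)
open import Relation.Binary.PropositionalEquality
  using (_≡_; refl; sym; trans; cong; cong₂; subst; module ≡-Reasoning)

atMost-retract : {A B : Set} {g : A → B} {m : ℕ} (h : A → Fin m) (d : Fin m → B) →
                 (∀ x → d (h x) ≡ g x) → AtMost g m
atMost-retract h d d∘h≗g = h , λ x y hx≡hy →
  trans (sym (d∘h≗g x)) (trans (cong d hx≡hy) (d∘h≗g y))

atMost-comap : {A A′ B : Set} {g : A → B} {g′ : A′ → B} {m : ℕ} (f : A → A′) →
               (∀ x → g′ (f x) ≡ g x) → AtMost g′ m → AtMost g m
atMost-comap f g′∘f≗g (h , inj) = (λ x → h (f x)) , λ x y hfx≡hfy →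
  trans (sym (g′∘f≗g x)) (trans (inj (f x) (f y) hfx≡hfy) (g′∘f≗g y))

module _ {A : Set} (L : List A) where

  Word : ℕ → Set
  Word k = Σ (List A) λ X → length X ≡ k × All (_∈ L) X

  encodeWord : {X : List A} → All (_∈ L) X → Fin (length L ^ length X)
  encodeWord []          = fzero
  encodeWord (x∈L ∷ X⊆L) = combine (index x∈L) (encodeWord X⊆L)

  decodeWord : (k : ℕ) → Fin (length L ^ k) → List A
  decodeWord 0       _ = []
  decodeWord (suc k) c =
    lookup L (quotient {length L} _ c) ∷ decodeWord k (remainder {length L} _ c)

  decodeWord-encodeWord : {X : List A} (X⊆L : All (_∈ L) X) →
                          decodeWord (length X) (encodeWord X⊆L) ≡ X
  decodeWord-encodeWord []                  = refl
  decodeWord-encodeWord {x ∷ X} (x∈L ∷ X⊆L) = begin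
    decodeWord (suc (length X)) (combine (index x∈L) (encodeWord X⊆L))
      ≡⟨ cong (λ (i , c) → lookup L i ∷ decodeWord (length X) c)
              (remQuot-combine (index x∈L) (encodeWord X⊆L)) ⟩
    lookup L (index x∈L) ∷ decodeWord (length X) (encodeWord X⊆L)
      ≡⟨ cong₂ _∷_ (sym (lookup-index x∈L)) (decodeWord-encodeWord X⊆L) ⟩
    x ∷ X ∎
    where open ≡-Reasoning

  word-atMost : (k : ℕ) → AtMost {Word k} proj₁ (length L ^ k)
  word-atMost k = atMost-retract encode (decodeWord k) decode-encode
    where
    encode : Word k → Fin (length L ^ k)
    encode (X , |X|≡k , X⊆L) = subst (λ m → Fin (length L ^ m)) |X|≡k (encodeWord X⊆L)

    decode-encode : ∀ w → decodeWord k (encode w) ≡ proj₁ w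
    decode-encode (X , refl , X⊆L) = decodeWord-encodeWord X⊆L

registers : ℕ → List ℕ
registers m = applyUpTo suc m

inGets auxGets : ℕ → List Basic
inGets n  = map inGet (registers n)
auxGets a = map auxGet (registers a)

auxSets : Bool → ℕ → List Basic
auxSets b a = map (λ i → auxSet i b) (registers a)

outSets : List Basic
outSets = outSet false ∷ outSet true ∷ []

basicInstructions : ℕ → ℕ → List Basic
basicInstructions n a = inGets n ++ auxGets a ++ auxSets false a ++ auxSets true a ++ outSets

plainAndTests : List Basic → List Prim
plainAndTests B = map plain B ++ map ptest B ++ map ntest B

jumps : ℕ → List Prim
jumps j = map jump (upTo (suc j))

primitiveInstructions : ℕ → ℕ → ℕ → List Prim
primitiveInstructions n a j = plainAndTests (basicInstructions n a) ++ jumps j ++ halt ∷ []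

∈-registers : ∀ {i m} → 1 ≤ i → i ≤ m → i ∈ registers m
∈-registers {suc i} _ i<m = ∈-applyUpTo⁺ suc i<m

∈-auxSets : ∀ {i a} b → 1 ≤ i → i ≤ a → auxSet i b ∈ auxSets b a
∈-auxSets b 1≤i i≤a = ∈-map⁺ (λ i → auxSet i b) (∈-registers 1≤i i≤a)

okBasic⇒∈basicInstructions : ∀ {n a} x → OkBasic n a x → x ∈ basicInstructions n a
okBasic⇒∈basicInstructions (inGet i) (1≤i , i≤n) =
  ∈-++⁺ˡ (∈-map⁺ inGet (∈-registers 1≤i i≤n))
okBasic⇒∈basicInstructions {n} (auxGet i) (1≤i , i≤a) =
  ∈-++⁺ʳ (inGets n) (∈-++⁺ˡ (∈-map⁺ auxGet (∈-registers 1≤i i≤a)))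
okBasic⇒∈basicInstructions {n} {a} (auxSet i false) (1≤i , i≤a) =
  ∈-++⁺ʳ (inGets n) (∈-++⁺ʳ (auxGets a) (∈-++⁺ˡ (∈-auxSets false 1≤i i≤a)))
okBasic⇒∈basicInstructions {n} {a} (auxSet i true) (1≤i , i≤a) =
  ∈-++⁺ʳ (inGets n) (∈-++⁺ʳ (auxGets a) (∈-++⁺ʳ (auxSets false a)
    (∈-++⁺ˡ (∈-auxSets true 1≤i i≤a))))
okBasic⇒∈basicInstructions {n} {a} (outSet b) _ =
  ∈-++⁺ʳ (inGets n) (∈-++⁺ʳ (auxGets a) (∈-++⁺ʳ (auxSets false a)
    (∈-++⁺ʳ (auxSets true a) (∈-outSets b))))
  where
  ∈-outSets : ∀ b → outSet b ∈ outSets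
  ∈-outSets false = here refl
  ∈-outSets true  = there (here refl)

∈-plainAndTests : ∀ {B x} → x ∈ B →
                  plain x ∈ plainAndTests B × ptest x ∈ plainAndTests B × ntest x ∈ plainAndTests B
∈-plainAndTests {B} x∈B =
  ∈-++⁺ˡ (∈-map⁺ plain x∈B) ,
  ∈-++⁺ʳ (map plain B) (∈-++⁺ˡ (∈-map⁺ ptest x∈B)) ,
  ∈-++⁺ʳ (map plain B) (∈-++⁺ʳ (map ptest B) (∈-map⁺ ntest x∈B))

okPrim⇒∈primitiveInstructions : ∀ {n a j} u → OkPrim n a j u → u ∈ primitiveInstructions n a j
okPrim⇒∈primitiveInstructions (plain x) ok =
  ∈-++⁺ˡ (proj₁ (∈-plainAndTests (okBasic⇒∈basicInstructions x ok)))
okPrim⇒∈primitiveInstructions (ptest x) ok =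
  ∈-++⁺ˡ (proj₁ (proj₂ (∈-plainAndTests (okBasic⇒∈basicInstructions x ok))))
okPrim⇒∈primitiveInstructions (ntest x) ok =
  ∈-++⁺ˡ (proj₂ (proj₂ (∈-plainAndTests (okBasic⇒∈basicInstructions x ok))))
okPrim⇒∈primitiveInstructions {n} {a} (jump l) l≤j =
  ∈-++⁺ʳ (plainAndTests (basicInstructions n a)) (∈-++⁺ˡ (∈-map⁺ jump (∈-upTo⁺ (s≤s l≤j))))
okPrim⇒∈primitiveInstructions {n} {a} {j} halt _ =
  ∈-++⁺ʳ (plainAndTests (basicInstructions n a)) (∈-++⁺ʳ (jumps j) (here refl))

length-++-≡ : {A : Set} (xs : List A) {ys : List A} {p q : ℕ} →
              length xs ≡ p → length ys ≡ q → length (xs ++ ys) ≡ p + q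
length-++-≡ xs |xs|≡p |ys|≡q = trans (length-++ xs) (cong₂ _+_ |xs|≡p |ys|≡q)

length-map-registers : {A : Set} (f : ℕ → A) (m : ℕ) → length (map f (registers m)) ≡ m
length-map-registers f m = trans (length-map f (registers m)) (length-applyUpTo suc m)

length-basicInstructions : ∀ n a → length (basicInstructions n a) ≡ n + (a + (a + (a + 2)))
length-basicInstructions n a =
  length-++-≡ (inGets n) (length-map-registers inGet n)
  (length-++-≡ (auxGets a) (length-map-registers auxGet a)
  (length-++-≡ (auxSets false a) (length-map-registers _ a)
  (length-++-≡ (auxSets true a) (length-map-registers _ a) refl)))

length-primitiveInstructions : ∀ n a j → let b = n + (a + (a + (a + 2))) in
  length (primitiveInstructions n a j) ≡ (b + (b + b)) + (suc j + 1)
length-primitiveInstructions n a j =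
  length-++-≡ (plainAndTests B)
    (length-++-≡ (map plain B) (length-map-basics plain)
    (length-++-≡ (map ptest B) (length-map-basics ptest) (length-map-basics ntest)))
  (length-++-≡ (jumps j) (trans (length-map jump (upTo (suc j))) (length-upTo (suc j))) refl)
  where
  B = basicInstructions n a
  length-map-basics : (f : Basic → Prim) → length (map f B) ≡ n + (a + (a + (a + 2)))
  length-map-basics f = trans (length-map f B) (length-basicInstructions n a)

primitiveInstructionCount : ∀ n k →
  length (primitiveInstructions n k k) ≡ 3 * n + 10 * suc k ∸ 2
primitiveInstructionCount n k =
  trans (length-primitiveInstructions n k k) (cong (_∸ 2) (sym (count n k)))
  where
  count : ∀ n k → let b = n + (k + (k + (k + 2))) in
          3 * n + 10 * suc k ≡ 2 + ((b + (b + b)) + (suc k + 1))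
  count = solve-∀

proposition1 : (k n : ℕ) → 1 ≤ k →
    AtMost {Counted k n} proj₁ ((3 * n + 10 * k ∸ 2) ^ k)
proposition1 (suc k) n _ =
  subst (λ m → AtMost {Counted (suc k) n} proj₁ (m ^ suc k))
        (primitiveInstructionCount n k)
        (atMost-comap toWord (λ _ → refl) (word-atMost (primitiveInstructions n k k) (suc k)))
  where
  toWord : Counted (suc k) n → Word (primitiveInstructions n k k) (suc k)
  toWord (X , |X|≡k , X∈IS , _) = X , |X|≡k , All.map (okPrim⇒∈primitiveInstructions _) X∈IS
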